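{- For every squarefree integer $n\geq 2$, \[ a(n)=\sum_{\substack{d\mid n\\ d\neq 1}}(-1)^{\omega(d)+1}\frac{d}{d-\varphi(d)}, \] where $\omega(d)$ is the number of distinct prime divisors of $d$ and $\varphi$ is Euler's totient function.
   Context: For a positive integer $n$, consider the random walk on $\mathbb{Z}/n\mathbb{Z}$ that starts at the residue $1 \pmod n$ and at each step multiplies the current state by a residue chosen uniformly at random from $\mathbb{Z}/n\mathbb{Z}$, independently of previous choices. The state $0\pmod n$ is absorbing. $a(n)$ denotes the expected number of steps until the walk first reaches $0 \pmod n$. -}

module Defs where

open import Data.Nat using (ℕ; zero; suc; _*_; _∸_; _^_; _≤_)
open import Data.Nat.Divisibility using (_∣_; _∣?_)
open import Data.Nat.GCD using (gcd)
open import Data.Nat.Primality using (prime?)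
open import Data.Nat.Properties using (_≟_)
open import Data.Integer using (+_)
open import Data.List using (List; []; _∷_; map; concatMap; filter; length; upTo; foldr)
open import Data.Nat.ListAction using (product)
open import Data.Rational using (ℚ; _/_; 0ℚ; 1ℚ; -_; _+_)
open import Relation.Nullary using (¬?)
open import Relation.Binary.PropositionalEquality using (_≡_)
import Data.Rational

-- x / y as a rational number, with the (never used) convention x / 0 = 0
_÷ℕ_ : ℕ → ℕ → ℚ
x ÷ℕ zero = 0ℚ
x ÷ℕ suc y = (+ x) / suc y

sumℚ : List ℚ → ℚ
sumℚ = foldr _+_ 0ℚ

-- all length-k sequences of residues 0,…,n-1 (i.e. all of (ℤ/nℤ)^k)
tuples : ℕ → ℕ → List (List ℕ)
tuples n zero = [] ∷ []
tuples n (suc k) = concatMap (λ r → map (r ∷_) (tuples n k)) (upTo n)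

-- number of length-k multiplier sequences for which the walk, started at 1,
-- is not yet at 0 mod n after k steps (i.e. n ∤ r₁⋯r_k)
survivors : ℕ → ℕ → ℕ
survivors n k = length (filter (λ xs → ¬? (n ∣? product xs)) (tuples n k))

-- P(T > k) for the hitting time T of 0 mod n
tailProb : ℕ → ℕ → ℚ
tailProb n k = survivors n k ÷ℕ (n ^ k)

-- partial sum  Σ_{k<K} P(T > k);  E[T] = lim_{K→∞} of these
partialExp : ℕ → ℕ → ℚ
partialExp n K = sumℚ (map (tailProb n) (upTo K))

φ : ℕ → ℕ
φ d = length (filter (λ k → gcd (suc k) d ≟ 1) (upTo d))

ω : ℕ → ℕ
ω d = length (filter (λ p → p ∣? d) (filter prime? (upTo (suc d))))

divisors : ℕ → List ℕ
divisors n = filter (λ d → d ∣? n) (map suc (upTo n))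

negOnePow : ℕ → ℚ
negOnePow zero = 1ℚ
negOnePow (suc k) = - negOnePow k

term : ℕ → ℚ
term d = negOnePow (suc (ω d)) Data.Rational.* (d ÷ℕ (d ∸ φ d))

rhs : ℕ → ℚ
rhs n = sumℚ (map term (filter (λ d → ¬? (d ≟ 1)) (divisors n)))

SquareFree : ℕ → Set
SquareFree n = ∀ m → m * m ∣ n → m ≡ 1

-- If T is the hitting time of 0, then P(T > k) is the proportion of k-tuples of residues mod n whose
-- product is not divisible by n. For squarefree n, n divides x exactly when every prime factor of n
-- does, so inclusion-exclusion over the prime factors gives [n ∤ x] = ∑_{1 ≠ d ∣ n} -μ(d) [gcd(d, x) = 1].
-- Coprimality to d is multiplicative in x and a fraction φ(d)/d of the residues mod n are coprime
-- to d, hence P(T > k) = ∑_{1 ≠ d ∣ n} -μ(d) (φ(d)/d)^k. Summing the geometric series in k, the K-th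
-- partial sum of E[T] = ∑_k P(T > k) differs from the right-hand side by
-- ∑_d μ(d) (d/(d - φ(d))) (φ(d)/d)^K, and Bernoulli's inequality bounds K times this error by n³.

module Submission where

open import Defs
open import Data.Nat using (ℕ; _≤_)
open import Data.Product using (∃-syntax; _×_; _,_; proj₁; proj₂)
open import Data.Rational using (ℚ; 0ℚ; _<_; _-_; ∣_∣)
import Data.Rational as ℚ

open import Algebra.Bundles using (CommutativeMonoid; CommutativeRing)
import Algebra.Properties.CommutativeSemigroup as CommutativeSemigroupProperties
import Algebra.Properties.Group
open import Data.Empty using (⊥-elim)
import Data.Integer.Base as ℤ
open import Data.Integer.Tactic.RingSolver using () renaming (solve-∀ to ℤ-solve-∀)
open import Data.List.Base using (List; []; _∷_; _∷ʳ_; _++_; map; concatMap; filter; length; upTo)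
import Data.List.Properties as List
open import Data.List.Membership.Propositional using (_∈_; lose)
open import Data.List.Membership.Propositional.Properties
open import Data.List.Membership.Propositional.Properties.WithK using (unique∧set⇒bag)
open import Data.List.Relation.Binary.BagAndSetEquality using (∼bag⇒↭)
open import Data.List.Relation.Binary.Permutation.Propositional using (_↭_; ↭⇒↭ₛ)
import Data.List.Relation.Binary.Permutation.Propositional.Properties as ↭
open import Data.List.Relation.Unary.All as All using (All; []; _∷_)
open import Data.List.Relation.Unary.AllPairs using (_∷_)
open import Data.List.Relation.Unary.Any using (here; there)
open import Data.List.Relation.Unary.Unique.Propositional using (Unique)
import Data.List.Relation.Unary.Unique.Propositional.Properties as Unique
open import Data.Nat.Base as ℕ using (zero; suc; NonZero; _∸_)
open import Data.Nat.Coprimality as Coprime using (Coprime; coprime?; coprime-divisor)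
open import Data.Nat.Divisibility
open import Data.Nat.GCD using (gcd; gcd-greatest)
open import Data.Nat.ListAction using (product)
open import Data.Nat.Primality
  using (Prime; prime?; prime⇒irreducible; prime⇒nonZero; ¬prime[1]; euclidsLemma; productOfPrimes≢0)
open import Data.Nat.Primality.Factorisation using (factorise)
import Data.Nat.Properties as ℕ
open import Data.Rational.Base using (1ℚ; _+_; _*_; -_; mkℚ)
import Data.Rational.Properties as ℚ
open import Data.Rational.Solver using (module +-*-Solver)
import Data.Rational.Unnormalised as ℚᵘ
import Data.Rational.Unnormalised.Properties as ℚᵘ
open import Data.Sum using (inj₁; inj₂)
open import Function.Base using (_∘_)
open import Function.Bundles using (_⇔_; Equivalence; mk⇔)
open import Level using (0ℓ)
open import Relation.Binary.Definitions using (DecidableEquality)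
open import Relation.Binary.PropositionalEquality
open import Relation.Nullary using (Dec; yes; no; ¬_; ¬?)
open import Relation.Nullary.Decidable using (_×-dec_; decidable-stable)
open import Relation.Unary using (Pred; Decidable)

open +-*-Solver using (solve; _:+_; _:*_; _:-_; :-_; con; _:=_)
open import Data.List.Relation.Binary.Permutation.Setoid.Properties ℚ.≡-setoid using (foldr-commMonoid)
open CommutativeRing ℚ.+-*-commutativeRing using (semiring; commutativeSemiring)
open import Algebra.Properties.CommutativeSemiring.Exp commutativeSemiring using (_^_; ^-distrib-*)
open import Algebra.Properties.Semiring.Mult semiring using (×-homo-+; ×1-homo-*) renaming (_×_ to _·_)

private
  variable
    A B P Q : Set

  module +-G = Algebra.Properties.Group ℚ.+-0-group
  module +-CS = CommutativeSemigroupProperties (CommutativeMonoid.commutativeSemigroup ℚ.+-0-commutativeMonoid)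
  module *-CS = CommutativeSemigroupProperties (CommutativeMonoid.commutativeSemigroup ℚ.*-1-commutativeMonoid)

-- The embedding of ℕ into ℚ

fromℕ : ℕ → ℚ
fromℕ n = n · 1ℚ

fromℕ-+ : ∀ m n → fromℕ (m ℕ.+ n) ≡ fromℕ m + fromℕ n
fromℕ-+ = ×-homo-+ 1ℚ

fromℕ-* : ∀ m n → fromℕ (m ℕ.* n) ≡ fromℕ m * fromℕ n
fromℕ-* = ×1-homo-*

fromℕ-^ : ∀ m k → fromℕ (m ℕ.^ k) ≡ fromℕ m ^ k
fromℕ-^ m zero    = refl
fromℕ-^ m (suc k) = trans (fromℕ-* m (m ℕ.^ k)) (cong (fromℕ m *_) (fromℕ-^ m k))

fromℕ-∸ : ∀ {m n} → n ≤ m → fromℕ (m ∸ n) ≡ fromℕ m - fromℕ n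
fromℕ-∸ {m} {n} n≤m = begin
  fromℕ (m ∸ n)                     ≡⟨ x≡x+y-y (fromℕ (m ∸ n)) (fromℕ n) ⟩
  fromℕ (m ∸ n) + fromℕ n - fromℕ n ≡⟨ cong (_- fromℕ n) (sym (fromℕ-+ (m ∸ n) n)) ⟩
  fromℕ (m ∸ n ℕ.+ n) - fromℕ n     ≡⟨ cong (λ k → fromℕ k - fromℕ n) (ℕ.m∸n+n≡m n≤m) ⟩
  fromℕ m - fromℕ n                 ∎
  where
  open ≡-Reasoning
  x≡x+y-y : ∀ x y → x ≡ x + y - y
  x≡x+y-y = solve 2 (λ x y → x := x :+ y :- y) refl

0<1 : 0ℚ < 1ℚ
0<1 = ℚ.positive⁻¹ 1ℚ

fromℕ-nonNeg : ∀ n → 0ℚ ℚ.≤ fromℕ n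
fromℕ-nonNeg zero    = ℚ.≤-refl
fromℕ-nonNeg (suc n) = ℚ.+-mono-≤ (ℚ.<⇒≤ 0<1) (fromℕ-nonNeg n)

fromℕ-pos : ∀ n → .{{NonZero n}} → 0ℚ < fromℕ n
fromℕ-pos (suc n) = ℚ.+-mono-<-≤ 0<1 (fromℕ-nonNeg n)

fromℕ-mono-≤ : ∀ {m n} → m ≤ n → fromℕ m ℚ.≤ fromℕ n
fromℕ-mono-≤ {m} {n} m≤n = begin
  fromℕ m                 ≡⟨ ℚ.+-identityʳ (fromℕ m) ⟨
  fromℕ m + 0ℚ            ≤⟨ ℚ.+-monoʳ-≤ (fromℕ m) (fromℕ-nonNeg (n ∸ m)) ⟩
  fromℕ m + fromℕ (n ∸ m) ≡⟨ fromℕ-+ m (n ∸ m) ⟨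
  fromℕ (m ℕ.+ (n ∸ m))   ≡⟨ cong fromℕ (ℕ.m+[n∸m]≡n m≤n) ⟩
  fromℕ n                 ∎
  where open ℚ.≤-Reasoning

toℚᵘ-fromℕ : ∀ n → ℚ.toℚᵘ (fromℕ n) ℚᵘ.≃ ℚᵘ.mkℚᵘ (ℤ.+ n) 0
toℚᵘ-fromℕ zero    = ℚᵘ.≃-refl
toℚᵘ-fromℕ (suc n) = begin
  ℚ.toℚᵘ (1ℚ + fromℕ n)         ≈⟨ ℚ.toℚᵘ-homo-+ 1ℚ (fromℕ n) ⟩
  ℚᵘ.1ℚᵘ ℚᵘ.+ ℚ.toℚᵘ (fromℕ n)  ≈⟨ ℚᵘ.+-congʳ ℚᵘ.1ℚᵘ (toℚᵘ-fromℕ n) ⟩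
  ℚᵘ.1ℚᵘ ℚᵘ.+ ℚᵘ.mkℚᵘ (ℤ.+ n) 0 ≈⟨ ℚᵘ.*≡* (cross-multiplied (ℤ.+ n)) ⟩
  ℚᵘ.mkℚᵘ (ℤ.+ suc n) 0         ∎
  where
  open ℚᵘ.≃-Reasoning
  cross-multiplied : ∀ i → (ℤ.1ℤ ℤ.* ℤ.1ℤ ℤ.+ i ℤ.* ℤ.1ℤ) ℤ.* ℤ.1ℤ ≡ (ℤ.1ℤ ℤ.+ i) ℤ.* (ℤ.1ℤ ℤ.* ℤ.1ℤ)
  cross-multiplied = ℤ-solve-∀

-- ℚ's _/_ normalises by a gcd, which does not compute on variables, so the identity is
-- checked on unnormalised representatives.
m÷n*n≡m : ∀ m n → .{{_ : NonZero n}} → (m ÷ℕ n) * fromℕ n ≡ fromℕ m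
m÷n*n≡m m (suc n) = ℚ.toℚᵘ-injective (begin
  ℚ.toℚᵘ ((ℤ.+ m ℚ./ suc n) * fromℕ (suc n))           ≈⟨ ℚ.toℚᵘ-homo-* (ℤ.+ m ℚ./ suc n) (fromℕ (suc n)) ⟩
  ℚ.toℚᵘ (ℤ.+ m ℚ./ suc n) ℚᵘ.* ℚ.toℚᵘ (fromℕ (suc n)) ≈⟨ ℚᵘ.*-cong (ℚ.toℚᵘ-fromℚᵘ (ℚᵘ.mkℚᵘ (ℤ.+ m) n)) (toℚᵘ-fromℕ (suc n)) ⟩
  ℚᵘ.mkℚᵘ (ℤ.+ m) n ℚᵘ.* ℚᵘ.mkℚᵘ (ℤ.+ suc n) 0         ≈⟨ ℚᵘ.*≡* (cross-multiplied (ℤ.+ m) (ℤ.+ suc n)) ⟩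
  ℚᵘ.mkℚᵘ (ℤ.+ m) 0                                    ≈⟨ toℚᵘ-fromℕ m ⟨
  ℚ.toℚᵘ (fromℕ m)                                     ∎)
  where
  open ℚᵘ.≃-Reasoning
  cross-multiplied : ∀ i j → (i ℤ.* j) ℤ.* ℤ.1ℤ ≡ i ℤ.* (j ℤ.* ℤ.1ℤ)
  cross-multiplied = ℤ-solve-∀

*-cancelʳ-≡-pos : ∀ {a b} c → 0ℚ < c → a * c ≡ b * c → a ≡ b
*-cancelʳ-≡-pos c c>0 eq = ℚ.≤-antisym (cancel eq) (cancel (sym eq))
  where
  cancel : ∀ {a b} → a * c ≡ b * c → a ℚ.≤ b
  cancel e = ℚ.*-cancelʳ-≤-pos c {{ℚ.positive c>0}} (ℚ.≤-reflexive e)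

÷ℕ-unique : ∀ {x} m n → .{{_ : NonZero n}} → x * fromℕ n ≡ fromℕ m → m ÷ℕ n ≡ x
÷ℕ-unique m n eq = *-cancelʳ-≡-pos (fromℕ n) (fromℕ-pos n) (trans (m÷n*n≡m m n) (sym eq))

÷ℕ-nonNeg : ∀ m n → 0ℚ ℚ.≤ m ÷ℕ n
÷ℕ-nonNeg m zero    = ℚ.≤-refl
÷ℕ-nonNeg m (suc n) = ℚ.nonNegative⁻¹ _ {{ℚ.normalize-nonNeg m (suc n)}}

*-monoˡ-≤-nonNeg′ : ∀ {a b} c → 0ℚ ℚ.≤ c → a ℚ.≤ b → c * a ℚ.≤ c * b
*-monoˡ-≤-nonNeg′ c c≥0 = ℚ.*-monoˡ-≤-nonNeg c {{ℚ.nonNegative c≥0}}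

*-monoʳ-≤-nonNeg′ : ∀ {a b} c → 0ℚ ℚ.≤ c → a ℚ.≤ b → a * c ℚ.≤ b * c
*-monoʳ-≤-nonNeg′ c c≥0 = ℚ.*-monoʳ-≤-nonNeg c {{ℚ.nonNegative c≥0}}

nonNeg*nonNeg⇒nonNeg′ : ∀ {a b} → 0ℚ ℚ.≤ a → 0ℚ ℚ.≤ b → 0ℚ ℚ.≤ a * b
nonNeg*nonNeg⇒nonNeg′ {a} {b} a≥0 b≥0 =
  ℚ.nonNegative⁻¹ _ {{ℚ.nonNeg*nonNeg⇒nonNeg a {{ℚ.nonNegative a≥0}} b {{ℚ.nonNegative b≥0}}}}

x-y≤x : ∀ x {y} → 0ℚ ℚ.≤ y → x - y ℚ.≤ x
x-y≤x x {y} y≥0 = ℚ.≤-trans (ℚ.+-monoʳ-≤ x (ℚ.neg-antimono-≤ y≥0)) (ℚ.≤-reflexive (ℚ.+-identityʳ x))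

^-nonNeg : ∀ {q} k → 0ℚ ℚ.≤ q → 0ℚ ℚ.≤ q ^ k
^-nonNeg zero    q≥0 = ℚ.<⇒≤ 0<1
^-nonNeg (suc k) q≥0 = nonNeg*nonNeg⇒nonNeg′ q≥0 (^-nonNeg k q≥0)

-- Finite sums

∑ : List A → (A → ℚ) → ℚ
∑ xs f = sumℚ (map f xs)

infix 6.5 ∑
syntax ∑ xs (λ x → e) = ∑[ x ∈ xs ] e

∑-++ : ∀ (xs ys : List A) f → ∑ (xs ++ ys) f ≡ ∑ xs f + ∑ ys f
∑-++ []       ys f = sym (ℚ.+-identityˡ _)
∑-++ (x ∷ xs) ys f = trans (cong (f x +_) (∑-++ xs ys f)) (sym (ℚ.+-assoc (f x) _ _))

∑-cong : ∀ (xs : List A) {f g} → (∀ {x} → x ∈ xs → f x ≡ g x) → ∑ xs f ≡ ∑ xs g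
∑-cong []       f≡g = refl
∑-cong (x ∷ xs) f≡g = cong₂ _+_ (f≡g (here refl)) (∑-cong xs (f≡g ∘ there))

∑-map : ∀ (g : A → B) (xs : List A) f → ∑ (map g xs) f ≡ ∑ xs (f ∘ g)
∑-map g xs f = cong sumℚ (sym (List.map-∘ xs))

∑-concatMap : ∀ (g : A → List B) (xs : List A) f →
              ∑ (concatMap g xs) f ≡ ∑[ x ∈ xs ] ∑ (g x) f
∑-concatMap g []       f = refl
∑-concatMap g (x ∷ xs) f = trans (∑-++ (g x) (concatMap g xs) f) (cong (∑ (g x) f +_) (∑-concatMap g xs f))

∑-0 : ∀ (xs : List A) → ∑[ x ∈ xs ] 0ℚ ≡ 0ℚ
∑-0 []       = refl
∑-0 (x ∷ xs) = trans (ℚ.+-identityˡ _) (∑-0 xs)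

∑-+ : ∀ (xs : List A) f g → ∑[ x ∈ xs ] (f x + g x) ≡ ∑ xs f + ∑ xs g
∑-+ []       f g = refl
∑-+ (x ∷ xs) f g = trans (cong (f x + g x +_) (∑-+ xs f g)) (+-CS.interchange (f x) (g x) _ _)

∑-*ˡ : ∀ (xs : List A) c f → ∑[ x ∈ xs ] (c * f x) ≡ c * ∑ xs f
∑-*ˡ []       c f = sym (ℚ.*-zeroʳ c)
∑-*ˡ (x ∷ xs) c f = trans (cong (c * f x +_) (∑-*ˡ xs c f)) (sym (ℚ.*-distribˡ-+ c (f x) _))

∑-*ʳ : ∀ (xs : List A) c f → ∑[ x ∈ xs ] (f x * c) ≡ ∑ xs f * c
∑-*ʳ xs c f = trans (∑-cong xs λ {x} _ → ℚ.*-comm (f x) c) (trans (∑-*ˡ xs c f) (ℚ.*-comm c _))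

∑-neg : ∀ (xs : List A) f → ∑[ x ∈ xs ] (- f x) ≡ - ∑ xs f
∑-neg []       f = refl
∑-neg (x ∷ xs) f = trans (cong (- f x +_) (∑-neg xs f)) (sym (ℚ.neg-distrib-+ (f x) _))

∑-minus : ∀ (xs : List A) f g → ∑[ x ∈ xs ] (f x - g x) ≡ ∑ xs f - ∑ xs g
∑-minus xs f g = trans (∑-+ xs f (λ x → - g x)) (cong (∑ xs f +_) (∑-neg xs g))

∑-swap : ∀ (xs : List A) (ys : List B) (F : A → B → ℚ) →
         ∑[ x ∈ xs ] ∑[ y ∈ ys ] F x y ≡ ∑[ y ∈ ys ] ∑[ x ∈ xs ] F x y
∑-swap []       ys F = sym (∑-0 ys)
∑-swap (x ∷ xs) ys F = trans (cong (∑ ys (F x) +_) (∑-swap xs ys F)) (sym (∑-+ ys (F x) _))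

∑-↭ : ∀ {xs ys : List A} f → xs ↭ ys → ∑ xs f ≡ ∑ ys f
∑-↭ f xs↭ys = foldr-commMonoid ℚ.+-0-isCommutativeMonoid (↭⇒↭ₛ (↭.map⁺ f xs↭ys))

∑-const : ∀ (xs : List A) c → ∑[ x ∈ xs ] c ≡ fromℕ (length xs) * c
∑-const []       c = sym (ℚ.*-zeroˡ c)
∑-const (x ∷ xs) c = begin
  c + ∑[ x ∈ xs ] c              ≡⟨ cong₂ _+_ (sym (ℚ.*-identityˡ c)) (∑-const xs c) ⟩
  1ℚ * c + fromℕ (length xs) * c ≡⟨ ℚ.*-distribʳ-+ c 1ℚ (fromℕ (length xs)) ⟨
  fromℕ (suc (length xs)) * c    ∎
  where open ≡-Reasoning

∑-mono-≤ : ∀ (xs : List A) {f g} → (∀ {x} → x ∈ xs → f x ℚ.≤ g x) → ∑ xs f ℚ.≤ ∑ xs g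
∑-mono-≤ []       f≤g = ℚ.≤-refl
∑-mono-≤ (x ∷ xs) f≤g = ℚ.+-mono-≤ (f≤g (here refl)) (∑-mono-≤ xs (f≤g ∘ there))

∣∑∣≤∑∣∣ : ∀ (xs : List A) f → ∣ ∑ xs f ∣ ℚ.≤ ∑[ x ∈ xs ] ∣ f x ∣
∣∑∣≤∑∣∣ []       f = ℚ.≤-refl
∣∑∣≤∑∣∣ (x ∷ xs) f = ℚ.≤-trans (ℚ.∣p+q∣≤∣p∣+∣q∣ (f x) (∑ xs f)) (ℚ.+-monoʳ-≤ ∣ f x ∣ (∣∑∣≤∑∣∣ xs f))

∑-upTo-sucʳ : ∀ n f → ∑ (upTo (suc n)) f ≡ ∑ (upTo n) f + f n
∑-upTo-sucʳ n f = begin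
  ∑ (upTo (suc n)) f        ≡⟨ cong (λ xs → ∑ xs f) (List.upTo-∷ʳ n) ⟨
  ∑ (upTo n ∷ʳ n) f         ≡⟨ ∑-++ (upTo n) (n ∷ []) f ⟩
  ∑ (upTo n) f + (f n + 0ℚ) ≡⟨ cong (∑ (upTo n) f +_) (ℚ.+-identityʳ (f n)) ⟩
  ∑ (upTo n) f + f n        ∎
  where open ≡-Reasoning

∑-upTo-sucˡ : ∀ n f → ∑ (upTo (suc n)) f ≡ f 0 + ∑[ r ∈ upTo n ] f (suc r)
∑-upTo-sucˡ n f =
  cong (f 0 +_) (trans (cong (λ xs → ∑ xs f) (sym (List.map-upTo suc n))) (∑-map suc (upTo n) f))

∑-upTo-+ : ∀ m n f → ∑ (upTo (m ℕ.+ n)) f ≡ ∑ (upTo m) f + ∑[ r ∈ upTo n ] f (m ℕ.+ r)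
∑-upTo-+ m zero    f = trans (cong (λ k → ∑ (upTo k) f) (ℕ.+-identityʳ m)) (sym (ℚ.+-identityʳ _))
∑-upTo-+ m (suc n) f = begin
  ∑ (upTo (m ℕ.+ suc n)) f                                   ≡⟨ cong (λ k → ∑ (upTo k) f) (ℕ.+-suc m n) ⟩
  ∑ (upTo (suc (m ℕ.+ n))) f                                 ≡⟨ ∑-upTo-sucʳ (m ℕ.+ n) f ⟩
  ∑ (upTo (m ℕ.+ n)) f + f (m ℕ.+ n)                         ≡⟨ cong (_+ f (m ℕ.+ n)) (∑-upTo-+ m n f) ⟩
  ∑ (upTo m) f + ∑[ r ∈ upTo n ] f (m ℕ.+ r) + f (m ℕ.+ n)   ≡⟨ ℚ.+-assoc (∑ (upTo m) f) (∑[ r ∈ upTo n ] f (m ℕ.+ r)) (f (m ℕ.+ n)) ⟩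
  ∑ (upTo m) f + (∑[ r ∈ upTo n ] f (m ℕ.+ r) + f (m ℕ.+ n)) ≡⟨ cong (∑ (upTo m) f +_) (∑-upTo-sucʳ n (λ r → f (m ℕ.+ r))) ⟨
  ∑ (upTo m) f + ∑[ r ∈ upTo (suc n) ] f (m ℕ.+ r)           ∎
  where open ≡-Reasoning

∑-upTo-periodic : ∀ d t f → (∀ r → f (d ℕ.+ r) ≡ f r) →
                  ∑ (upTo (t ℕ.* d)) f ≡ fromℕ t * ∑ (upTo d) f
∑-upTo-periodic d zero    f periodic = sym (ℚ.*-zeroˡ (∑ (upTo d) f))
∑-upTo-periodic d (suc t) f periodic = begin
  ∑ (upTo (d ℕ.+ t ℕ.* d)) f                         ≡⟨ ∑-upTo-+ d (t ℕ.* d) f ⟩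
  ∑ (upTo d) f + ∑[ r ∈ upTo (t ℕ.* d) ] f (d ℕ.+ r) ≡⟨ cong (∑ (upTo d) f +_) (∑-cong (upTo (t ℕ.* d)) (λ {r} _ → periodic r)) ⟩
  ∑ (upTo d) f + ∑ (upTo (t ℕ.* d)) f                ≡⟨ cong (∑ (upTo d) f +_) (∑-upTo-periodic d t f periodic) ⟩
  ∑ (upTo d) f + fromℕ t * ∑ (upTo d) f              ≡⟨ cong (_+ fromℕ t * ∑ (upTo d) f) (ℚ.*-identityˡ (∑ (upTo d) f)) ⟨
  1ℚ * ∑ (upTo d) f + fromℕ t * ∑ (upTo d) f         ≡⟨ ℚ.*-distribʳ-+ (∑ (upTo d) f) 1ℚ (fromℕ t) ⟨
  fromℕ (suc t) * ∑ (upTo d) f                       ∎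
  where open ≡-Reasoning

∑-upTo-rotate : ∀ d f → f d ≡ f 0 → ∑[ r ∈ upTo d ] f (suc r) ≡ ∑ (upTo d) f
∑-upTo-rotate d f fd≡f0 = +-G.∙-cancelˡ (f 0) _ _ (begin
  f 0 + ∑[ r ∈ upTo d ] f (suc r) ≡⟨ ∑-upTo-sucˡ d f ⟨
  ∑ (upTo (suc d)) f              ≡⟨ ∑-upTo-sucʳ d f ⟩
  ∑ (upTo d) f + f d              ≡⟨ ℚ.+-comm _ (f d) ⟩
  f d + ∑ (upTo d) f              ≡⟨ cong (_+ ∑ (upTo d) f) fd≡f0 ⟩
  f 0 + ∑ (upTo d) f              ∎)
  where open ≡-Reasoning

unique∧set⇒↭ : ∀ {xs ys : List A} → Unique xs → Unique ys → (∀ {z} → z ∈ xs ⇔ z ∈ ys) → xs ↭ ys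
unique∧set⇒↭ xs! ys! xs⇔ys = ∼bag⇒↭ (unique∧set⇒bag xs! ys! xs⇔ys)

module _ {A : Set} (_≟_ : DecidableEquality A) where

  ∑-remove : ∀ {x xs} → Unique xs → x ∈ xs → ∀ f → ∑ xs f ≡ f x + ∑ (filter (λ y → ¬? (y ≟ x)) xs) f
  ∑-remove {x} {xs} xs! x∈xs f = ∑-↭ f (unique∧set⇒↭ xs! (x∉rest ∷ Unique.filter⁺ ≢x? xs!) (mk⇔ to from))
    where
    ≢x? = λ y → ¬? (y ≟ x)
    x∉rest : All (x ≢_) (filter ≢x? xs)
    x∉rest = All.tabulate λ y∈ x≡y → proj₂ (∈-filter⁻ ≢x? {xs = xs} y∈) (sym x≡y)
    to : ∀ {z} → z ∈ xs → z ∈ x ∷ filter ≢x? xs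
    to {z} z∈ with z ≟ x
    ... | yes z≡x = here z≡x
    ... | no z≢x  = there (∈-filter⁺ ≢x? z∈ z≢x)
    from : ∀ {z} → z ∈ x ∷ filter ≢x? xs → z ∈ xs
    from (here refl) = x∈xs
    from (there z∈)  = proj₁ (∈-filter⁻ ≢x? {xs = xs} z∈)

𝟙 : Dec P → ℚ
𝟙 (yes _) = 1ℚ
𝟙 (no _)  = 0ℚ

𝟙-⇔ : ∀ (p? : Dec P) (q? : Dec Q) → P ⇔ Q → 𝟙 p? ≡ 𝟙 q?
𝟙-⇔ (yes _) (yes _) _   = refl
𝟙-⇔ (yes p) (no ¬q) p⇔q = ⊥-elim (¬q (Equivalence.to p⇔q p))
𝟙-⇔ (no ¬p) (yes q) p⇔q = ⊥-elim (¬p (Equivalence.from p⇔q q))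
𝟙-⇔ (no _)  (no _)  _   = refl

𝟙-× : ∀ (p? : Dec P) (q? : Dec Q) → 𝟙 (p? ×-dec q?) ≡ 𝟙 p? * 𝟙 q?
𝟙-× (yes _) (yes _) = refl
𝟙-× (yes _) (no _)  = refl
𝟙-× (no _)  (yes _) = refl
𝟙-× (no _)  (no _)  = refl

𝟙-¬ : ∀ (p? : Dec P) → 𝟙 (¬? p?) ≡ 1ℚ - 𝟙 p?
𝟙-¬ (yes _) = refl
𝟙-¬ (no _)  = refl

𝟙-yes : ∀ (p? : Dec P) → P → 𝟙 p? ≡ 1ℚ
𝟙-yes (yes _) _ = refl
𝟙-yes (no ¬p) p = ⊥-elim (¬p p)

fromℕ-length-filter : ∀ {P : Pred A 0ℓ} (P? : Decidable P) xs →
                      fromℕ (length (filter P? xs)) ≡ ∑[ x ∈ xs ] 𝟙 (P? x)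
fromℕ-length-filter P? []       = refl
fromℕ-length-filter P? (x ∷ xs) with P? x
... | yes _ = cong (1ℚ +_) (fromℕ-length-filter P? xs)
... | no _  = trans (fromℕ-length-filter P? xs) (sym (ℚ.+-identityˡ _))

-- Coprimality and divisors

prime∤⇒coprime : ∀ {p n} → Prime p → ¬ p ∣ n → Coprime p n
prime∤⇒coprime p-prime p∤n (i∣p , i∣n) with prime⇒irreducible p-prime i∣p
... | inj₁ i≡1 = i≡1
... | inj₂ refl = ⊥-elim (p∤n i∣n)

prime-∣⇔¬coprime : ∀ {p n} → Prime p → p ∣ n ⇔ (¬ Coprime p n)
prime-∣⇔¬coprime {p} {n} p-prime = mk⇔
  (λ p∣n coprime → ¬prime[1] (subst Prime (coprime (∣-refl , p∣n)) p-prime))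
  (λ ¬coprime → decidable-stable (p ∣? n) (¬coprime ∘ prime∤⇒coprime p-prime))

coprime-*ˡ⇔ : ∀ {a b c} → Coprime (a ℕ.* b) c ⇔ (Coprime a c × Coprime b c)
coprime-*ˡ⇔ {a} {b} {c} = mk⇔ split (λ (a⊥c , b⊥c) → join a⊥c b⊥c)
  where
  split : Coprime (a ℕ.* b) c → Coprime a c × Coprime b c
  split ab⊥c = (λ (i∣a , i∣c) → ab⊥c (∣-trans i∣a (m∣m*n b) , i∣c))
             , (λ (i∣b , i∣c) → ab⊥c (∣-trans i∣b (n∣m*n a) , i∣c))
  join : Coprime a c → Coprime b c → Coprime (a ℕ.* b) c
  join a⊥c b⊥c {i} (i∣ab , i∣c) = b⊥c (coprime-divisor i⊥a i∣ab , i∣c)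
    where
    i⊥a : Coprime i a
    i⊥a (j∣i , j∣a) = a⊥c (j∣a , ∣-trans j∣i i∣c)

coprime-*ʳ⇔ : ∀ {a b c} → Coprime c (a ℕ.* b) ⇔ (Coprime c a × Coprime c b)
coprime-*ʳ⇔ {a} {b} {c} = mk⇔ split join
  where
  split : Coprime c (a ℕ.* b) → Coprime c a × Coprime c b
  split c⊥ab with Equivalence.to coprime-*ˡ⇔ (Coprime.sym c⊥ab)
  ... | a⊥c , b⊥c = Coprime.sym a⊥c , Coprime.sym b⊥c
  join : Coprime c a × Coprime c b → Coprime c (a ℕ.* b)
  join (c⊥a , c⊥b) = Coprime.sym (Equivalence.from coprime-*ˡ⇔ (Coprime.sym c⊥a , Coprime.sym c⊥b))

coprime-+ˡ⇔ : ∀ {d r} → Coprime d (d ℕ.+ r) ⇔ Coprime d r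
coprime-+ˡ⇔ {d} {r} = mk⇔ drop add
  where
  drop : Coprime d (d ℕ.+ r) → Coprime d r
  drop d⊥d+r (i∣d , i∣r) = d⊥d+r (i∣d , ∣m∣n⇒∣m+n i∣d i∣r)
  add : Coprime d r → Coprime d (d ℕ.+ r)
  add d⊥r (i∣d , i∣d+r) = d⊥r (i∣d , ∣m+n∣m⇒∣n i∣d+r i∣d)

coprime-*-∣ : ∀ {m n x} → Coprime m n → m ∣ x → n ∣ x → m ℕ.* n ∣ x
coprime-*-∣ {m} {n} m⊥n m∣x (divides t refl) =
  *-monoˡ-∣ n (coprime-divisor m⊥n (subst (m ∣_) (ℕ.*-comm t n) m∣x))

𝟙-coprime-*ˡ : ∀ a b c → 𝟙 (coprime? (a ℕ.* b) c) ≡ 𝟙 (coprime? a c) * 𝟙 (coprime? b c)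
𝟙-coprime-*ˡ a b c =
  trans (𝟙-⇔ (coprime? (a ℕ.* b) c) (coprime? a c ×-dec coprime? b c) coprime-*ˡ⇔) (𝟙-× (coprime? a c) (coprime? b c))

𝟙-coprime-*ʳ : ∀ c a b → 𝟙 (coprime? c (a ℕ.* b)) ≡ 𝟙 (coprime? c a) * 𝟙 (coprime? c b)
𝟙-coprime-*ʳ c a b =
  trans (𝟙-⇔ (coprime? c (a ℕ.* b)) (coprime? c a ×-dec coprime? c b) coprime-*ʳ⇔) (𝟙-× (coprime? c a) (coprime? c b))

𝟙-coprime-periodic : ∀ d r → 𝟙 (coprime? d (d ℕ.+ r)) ≡ 𝟙 (coprime? d r)
𝟙-coprime-periodic d r = 𝟙-⇔ (coprime? d (d ℕ.+ r)) (coprime? d r) coprime-+ˡ⇔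

𝟙-∣-prime : ∀ {p} x → Prime p → 𝟙 (p ∣? x) ≡ 1ℚ - 𝟙 (coprime? p x)
𝟙-∣-prime {p} x p-prime = trans (𝟙-⇔ (p ∣? x) (¬? (coprime? p x)) (prime-∣⇔¬coprime p-prime)) (𝟙-¬ (coprime? p x))

𝟙-∣-*-coprime : ∀ {m n} x → Coprime m n → 𝟙 (m ℕ.* n ∣? x) ≡ 𝟙 (m ∣? x) * 𝟙 (n ∣? x)
𝟙-∣-*-coprime {m} {n} x m⊥n = trans (𝟙-⇔ (m ℕ.* n ∣? x) (m ∣? x ×-dec n ∣? x) mn∣x⇔m∣x×n∣x) (𝟙-× (m ∣? x) (n ∣? x))
  where
  mn∣x⇔m∣x×n∣x : (m ℕ.* n ∣ x) ⇔ ((m ∣ x) × (n ∣ x))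
  mn∣x⇔m∣x×n∣x = mk⇔ (λ mn∣x → m*n∣⇒m∣ m n mn∣x , m*n∣⇒n∣ m n mn∣x)
                     (λ (m∣x , n∣x) → coprime-*-∣ m⊥n m∣x n∣x)

∈-divisors⁺ : ∀ {d n} → .{{NonZero n}} → d ∣ n → d ∈ divisors n
∈-divisors⁺ {zero}  {n} 0∣n = ⊥-elim (ℕ.≢-nonZero⁻¹ n (0∣⇒≡0 0∣n))
∈-divisors⁺ {suc d} {n} d∣n = ∈-filter⁺ (_∣? n) (∈-map⁺ suc (∈-upTo⁺ (∣⇒≤ d∣n))) d∣n

∈-divisors⁻ : ∀ n {d} → d ∈ divisors n → d ∣ n
∈-divisors⁻ n = proj₂ ∘ ∈-filter⁻ (_∣? n) {xs = map suc (upTo n)}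

∈-divisors-nonZero : ∀ n {d} → d ∈ divisors n → NonZero d
∈-divisors-nonZero n d∈ with ∈-map⁻ suc (proj₁ (∈-filter⁻ (_∣? n) {xs = map suc (upTo n)} d∈))
... | _ , _ , refl = _

divisors-unique : ∀ n → Unique (divisors n)
divisors-unique n = Unique.filter⁺ (_∣? n) (Unique.map⁺ ℕ.suc-injective (Unique.upTo⁺ n))

divisors-*-prime : ∀ {p m} → Prime p → .{{_ : NonZero m}} → ¬ p ∣ m →
                   divisors (p ℕ.* m) ↭ divisors m ++ map (p ℕ.*_) (divisors m)
divisors-*-prime {p} {m} p-prime p∤m =
  unique∧set⇒↭ (divisors-unique (p ℕ.* m)) (Unique.++⁺ (divisors-unique m) p*-unique disjoint) (mk⇔ to from)
  where
  instance
    _ : NonZero p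
    _ = prime⇒nonZero p-prime
    _ : NonZero (p ℕ.* m)
    _ = ℕ.m*n≢0 p m
  p*-unique : Unique (map (p ℕ.*_) (divisors m))
  p*-unique = Unique.map⁺ (ℕ.*-cancelˡ-≡ _ _ p) (divisors-unique m)
  disjoint : ∀ {z} → ¬ (z ∈ divisors m × z ∈ map (p ℕ.*_) (divisors m))
  disjoint (z∈ , pw∈) with ∈-map⁻ (p ℕ.*_) pw∈
  ... | w , _ , refl = p∤m (∣-trans (m∣m*n w) (∈-divisors⁻ m z∈))
  to : ∀ {z} → z ∈ divisors (p ℕ.* m) → z ∈ divisors m ++ map (p ℕ.*_) (divisors m)
  to {z} z∈ with ∈-divisors⁻ (p ℕ.* m) z∈ | p ∣? z
  ... | z∣pm | yes (divides w refl) =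
    ∈-++⁺ʳ (divisors m) (subst (_∈ map (p ℕ.*_) (divisors m)) (ℕ.*-comm p w)
      (∈-map⁺ (p ℕ.*_) (∈-divisors⁺ (*-cancelˡ-∣ p (subst (_∣ p ℕ.* m) (ℕ.*-comm w p) z∣pm)))))
  ... | z∣pm | no p∤z =
    ∈-++⁺ˡ (∈-divisors⁺ (coprime-divisor (Coprime.sym (prime∤⇒coprime p-prime p∤z)) z∣pm))
  from : ∀ {z} → z ∈ divisors m ++ map (p ℕ.*_) (divisors m) → z ∈ divisors (p ℕ.* m)
  from {z} z∈ with ∈-++⁻ (divisors m) z∈
  ... | inj₁ z∈m = ∈-divisors⁺ (∣-trans (∈-divisors⁻ m z∈m) (n∣m*n p))
  ... | inj₂ pw∈ with ∈-map⁻ (p ℕ.*_) pw∈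
  ...   | w , w∈ , refl = ∈-divisors⁺ (*-monoʳ-∣ p (∈-divisors⁻ m w∈))

∑-divisors-*-prime : ∀ {p m} → Prime p → .{{_ : NonZero m}} → ¬ p ∣ m → ∀ f →
                     ∑ (divisors (p ℕ.* m)) f ≡ ∑ (divisors m) f + ∑[ d ∈ divisors m ] f (p ℕ.* d)
∑-divisors-*-prime {p} {m} p-prime p∤m f = begin
  ∑ (divisors (p ℕ.* m)) f                           ≡⟨ ∑-↭ f (divisors-*-prime p-prime p∤m) ⟩
  ∑ (divisors m ++ map (p ℕ.*_) (divisors m)) f      ≡⟨ ∑-++ (divisors m) _ f ⟩
  ∑ (divisors m) f + ∑ (map (p ℕ.*_) (divisors m)) f ≡⟨ cong (∑ (divisors m) f +_) (∑-map (p ℕ.*_) (divisors m) f) ⟩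
  ∑ (divisors m) f + ∑[ d ∈ divisors m ] f (p ℕ.* d) ∎
  where open ≡-Reasoning

nonunitDivisors : ℕ → List ℕ
nonunitDivisors n = filter (λ d → ¬? (d ℕ.≟ 1)) (divisors n)

∑-divisors : ∀ n → .{{NonZero n}} → ∀ f → ∑ (divisors n) f ≡ f 1 + ∑ (nonunitDivisors n) f
∑-divisors n = ∑-remove ℕ._≟_ (divisors-unique n) (∈-divisors⁺ (1∣ n))

∈-nonunitDivisors⁻ : ∀ n {d} → d ∈ nonunitDivisors n → d ∣ n × 1 ℕ.< d
∈-nonunitDivisors⁻ n {d} d∈ with ∈-filter⁻ (λ d → ¬? (d ℕ.≟ 1)) {xs = divisors n} d∈
... | d∈divisors , d≢1 =
  ∈-divisors⁻ n d∈divisors , ℕ.≤∧≢⇒< (ℕ.>-nonZero⁻¹ d {{∈-divisors-nonZero n d∈divisors}}) (d≢1 ∘ sym)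

length-nonunitDivisors : ∀ n → length (nonunitDivisors n) ≤ n
length-nonunitDivisors n = begin
  length (nonunitDivisors n) ≤⟨ List.length-filter (λ d → ¬? (d ℕ.≟ 1)) (divisors n) ⟩
  length (divisors n)        ≤⟨ List.length-filter (_∣? n) (map suc (upTo n)) ⟩
  length (map suc (upTo n))  ≡⟨ List.length-map suc (upTo n) ⟩
  length (upTo n)            ≡⟨ List.length-upTo n ⟩
  n                          ∎
  where open ℕ.≤-Reasoning

-- ω d is by definition the length of primeDivisors d.
primeDivisors : ℕ → List ℕ
primeDivisors d = filter (_∣? d) (filter prime? (upTo (suc d)))

∈-primeDivisors⁺ : ∀ {q d} → .{{NonZero d}} → Prime q → q ∣ d → q ∈ primeDivisors d
∈-primeDivisors⁺ {q} {d} q-prime q∣d =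
  ∈-filter⁺ (_∣? d) (∈-filter⁺ prime? (∈-upTo⁺ (ℕ.s≤s (∣⇒≤ q∣d))) q-prime) q∣d

∈-primeDivisors⁻ : ∀ d {q} → q ∈ primeDivisors d → Prime q × q ∣ d
∈-primeDivisors⁻ d q∈ with ∈-filter⁻ (_∣? d) {xs = filter prime? (upTo (suc d))} q∈
... | q∈primes , q∣d = proj₂ (∈-filter⁻ prime? {xs = upTo (suc d)} q∈primes) , q∣d

primeDivisors-unique : ∀ d → Unique (primeDivisors d)
primeDivisors-unique d = Unique.filter⁺ (_∣? d) (Unique.filter⁺ prime? (Unique.upTo⁺ (suc d)))

primeDivisors-*-prime : ∀ {p d} → Prime p → .{{_ : NonZero d}} → ¬ p ∣ d →
                        primeDivisors (p ℕ.* d) ↭ p ∷ primeDivisors d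
primeDivisors-*-prime {p} {d} p-prime p∤d =
  unique∧set⇒↭ (primeDivisors-unique (p ℕ.* d)) (p∉ ∷ primeDivisors-unique d) (mk⇔ to from)
  where
  instance
    _ : NonZero (p ℕ.* d)
    _ = ℕ.m*n≢0 p d {{prime⇒nonZero p-prime}}
  p∉ : All (p ≢_) (primeDivisors d)
  p∉ = All.tabulate λ q∈ p≡q → p∤d (subst (_∣ d) (sym p≡q) (proj₂ (∈-primeDivisors⁻ d q∈)))
  to : ∀ {q} → q ∈ primeDivisors (p ℕ.* d) → q ∈ p ∷ primeDivisors d
  to q∈ with ∈-primeDivisors⁻ (p ℕ.* d) q∈
  ... | q-prime , q∣pd with euclidsLemma p d q-prime q∣pd
  ...   | inj₂ q∣d = there (∈-primeDivisors⁺ q-prime q∣d)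
  ...   | inj₁ q∣p with prime⇒irreducible p-prime q∣p
  ...     | inj₁ refl = ⊥-elim (¬prime[1] q-prime)
  ...     | inj₂ q≡p = here q≡p
  from : ∀ {q} → q ∈ p ∷ primeDivisors d → q ∈ primeDivisors (p ℕ.* d)
  from (here refl) = ∈-primeDivisors⁺ p-prime (m∣m*n d)
  from (there q∈)  with ∈-primeDivisors⁻ d q∈
  ... | q-prime , q∣d = ∈-primeDivisors⁺ q-prime (∣-trans q∣d (n∣m*n p))

ω-*-prime : ∀ {p d} → Prime p → .{{_ : NonZero d}} → ¬ p ∣ d → ω (p ℕ.* d) ≡ suc (ω d)
ω-*-prime p-prime p∤d = ↭.↭-length (primeDivisors-*-prime p-prime p∤d)

-- The coprimality sieve and the tail probabilities

-- The Möbius function on squarefree arguments, which are the only ones it is applied to.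
μ : ℕ → ℚ
μ d = negOnePow (ω d)

μ-*-prime : ∀ {p d} → Prime p → .{{_ : NonZero d}} → ¬ p ∣ d → μ (p ℕ.* d) ≡ - μ d
μ-*-prime p-prime p∤d = cong negOnePow (ω-*-prime p-prime p∤d)

-- Inclusion-exclusion over the prime factors: for a prime p ∤ m,
-- [p m ∣ x] = (1 - [gcd(p, x) = 1]) [m ∣ x], and the product expands over the divisors of p m.
coprime-sieve-primes : ∀ {ps} → All Prime ps → SquareFree (product ps) → ∀ x →
                       ∑[ d ∈ divisors (product ps) ] μ d * 𝟙 (coprime? d x) ≡ 𝟙 (product ps ∣? x)
coprime-sieve-primes [] _ x =
  -- ∑ (divisors 1) F computes to 1ℚ * 𝟙 (coprime? 1 x) + 0ℚ
  trans (cong (λ c → 1ℚ * c + 0ℚ) (𝟙-yes (coprime? 1 x) (Coprime.1-coprimeTo x)))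
        (sym (𝟙-yes (1 ∣? x) (1∣ x)))
coprime-sieve-primes {p ∷ ps} (p-prime ∷ ps-prime) pm-squarefree x = begin
  ∑ (divisors (p ℕ.* m)) F                           ≡⟨ ∑-divisors-*-prime p-prime p∤m F ⟩
  ∑ (divisors m) F + ∑[ d ∈ divisors m ] F (p ℕ.* d) ≡⟨ cong (∑ (divisors m) F +_) (∑-cong (divisors m) F[p*d]) ⟩
  ∑ (divisors m) F + ∑[ d ∈ divisors m ] - c * F d   ≡⟨ cong (∑ (divisors m) F +_) (∑-*ˡ (divisors m) (- c) F) ⟩
  ∑ (divisors m) F + - c * ∑ (divisors m) F          ≡⟨ a+[-c]*a≡[1-c]*a (∑ (divisors m) F) c ⟩
  (1ℚ - c) * ∑ (divisors m) F                        ≡⟨ cong₂ _*_ (sym (𝟙-∣-prime x p-prime)) (coprime-sieve-primes ps-prime m-squarefree x) ⟩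
  𝟙 (p ∣? x) * 𝟙 (m ∣? x)                            ≡⟨ 𝟙-∣-*-coprime x (prime∤⇒coprime p-prime p∤m) ⟨
  𝟙 (p ℕ.* m ∣? x)                                   ∎
  where
  open ≡-Reasoning
  m = product ps
  instance
    _ : NonZero m
    _ = productOfPrimes≢0 ps-prime
  p∤m : ¬ p ∣ m
  p∤m p∣m = ¬prime[1] (subst Prime (pm-squarefree p (*-monoʳ-∣ p p∣m)) p-prime)
  m-squarefree : SquareFree m
  m-squarefree a aa∣m = pm-squarefree a (∣-trans aa∣m (n∣m*n p))
  c = 𝟙 (coprime? p x)
  F : ℕ → ℚ
  F d = μ d * 𝟙 (coprime? d x)
  F[p*d] : ∀ {d} → d ∈ divisors m → F (p ℕ.* d) ≡ - c * F d
  F[p*d] {d} d∈ = begin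
    μ (p ℕ.* d) * 𝟙 (coprime? (p ℕ.* d) x) ≡⟨ cong₂ _*_ (μ-*-prime p-prime p∤d) (𝟙-coprime-*ˡ p d x) ⟩
    - μ d * (c * 𝟙 (coprime? d x))         ≡⟨ [-a]*[b*c]≡[-b]*[a*c] (μ d) c (𝟙 (coprime? d x)) ⟩
    - c * F d                              ∎
    where
    instance
      _ : NonZero d
      _ = ∈-divisors-nonZero m d∈
    p∤d : ¬ p ∣ d
    p∤d p∣d = p∤m (∣-trans p∣d (∈-divisors⁻ m d∈))
    [-a]*[b*c]≡[-b]*[a*c] : ∀ a b c → - a * (b * c) ≡ - b * (a * c)
    [-a]*[b*c]≡[-b]*[a*c] = solve 3 (λ a b c → (:- a) :* (b :* c) := (:- b) :* (a :* c)) refl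
  a+[-c]*a≡[1-c]*a : ∀ a c → a + - c * a ≡ (1ℚ - c) * a
  a+[-c]*a≡[1-c]*a = solve 2 (λ a c → a :+ (:- c) :* a := (con 1ℚ :- c) :* a) refl

coprime-sieve : ∀ n → .{{NonZero n}} → SquareFree n → ∀ x →
                ∑[ d ∈ divisors n ] μ d * 𝟙 (coprime? d x) ≡ 𝟙 (n ∣? x)
coprime-sieve n n-squarefree x with factorise n
... | record { factors = ps ; isFactorisation = refl ; factorsPrime = ps-prime } =
  coprime-sieve-primes ps-prime n-squarefree x

𝟙-∤-sieve : ∀ n → .{{NonZero n}} → SquareFree n → ∀ x →
            𝟙 (¬? (n ∣? x)) ≡ ∑[ d ∈ nonunitDivisors n ] - μ d * 𝟙 (coprime? d x)
𝟙-∤-sieve n n-squarefree x = begin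
  𝟙 (¬? (n ∣? x))                     ≡⟨ 𝟙-¬ (n ∣? x) ⟩
  1ℚ - 𝟙 (n ∣? x)                     ≡⟨ cong (λ a → 1ℚ - a) (coprime-sieve n n-squarefree x) ⟨
  1ℚ - ∑ (divisors n) F               ≡⟨ cong (λ a → 1ℚ - a) (∑-divisors n F) ⟩
  1ℚ - (F 1 + ∑ D F)                  ≡⟨ cong (λ a → 1ℚ - (a + ∑ D F)) F1≡1 ⟩
  1ℚ - (1ℚ + ∑ D F)                   ≡⟨ 1-[1+a]≡-a (∑ D F) ⟩
  - ∑ D F                             ≡⟨ ∑-neg D F ⟨
  ∑[ d ∈ D ] - F d                    ≡⟨ ∑-cong D (λ {d} _ → ℚ.neg-distribˡ-* (μ d) (𝟙 (coprime? d x))) ⟩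
  ∑[ d ∈ D ] - μ d * 𝟙 (coprime? d x) ∎
  where
  open ≡-Reasoning
  D = nonunitDivisors n
  F : ℕ → ℚ
  F d = μ d * 𝟙 (coprime? d x)
  F1≡1 : F 1 ≡ 1ℚ
  F1≡1 = trans (ℚ.*-identityˡ _) (𝟙-yes (coprime? 1 x) (Coprime.1-coprimeTo x))
  1-[1+a]≡-a : ∀ a → 1ℚ - (1ℚ + a) ≡ - a
  1-[1+a]≡-a = solve 1 (λ a → con 1ℚ :- (con 1ℚ :+ a) := :- a) refl

fromℕ-φ : ∀ d → fromℕ (φ d) ≡ ∑[ r ∈ upTo d ] 𝟙 (coprime? d r)
fromℕ-φ d = begin
  fromℕ (φ d)                             ≡⟨ fromℕ-length-filter (λ k → gcd (suc k) d ℕ.≟ 1) (upTo d) ⟩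
  ∑[ k ∈ upTo d ] 𝟙 (gcd (suc k) d ℕ.≟ 1) ≡⟨ ∑-cong (upTo d) (λ {k} _ → 𝟙-⇔ (gcd (suc k) d ℕ.≟ 1) (coprime? d (suc k)) gcd≡1⇔coprime) ⟩
  ∑[ k ∈ upTo d ] 𝟙 (coprime? d (suc k))  ≡⟨ ∑-upTo-rotate d (𝟙 ∘ coprime? d) d⊥d≡d⊥0 ⟩
  ∑[ r ∈ upTo d ] 𝟙 (coprime? d r)        ∎
  where
  open ≡-Reasoning
  gcd≡1⇔coprime : ∀ {k} → gcd k d ≡ 1 ⇔ Coprime d k
  gcd≡1⇔coprime = mk⇔ (Coprime.sym ∘ Coprime.gcd≡1⇒coprime) (Coprime.coprime⇒gcd≡1 ∘ Coprime.sym)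
  d⊥d≡d⊥0 : 𝟙 (coprime? d d) ≡ 𝟙 (coprime? d 0)
  d⊥d≡d⊥0 = trans (cong (𝟙 ∘ coprime? d) (sym (ℕ.+-identityʳ d))) (𝟙-coprime-periodic d 0)

density : ℕ → ℚ
density d = φ d ÷ℕ d

∑-coprime-upTo : ∀ {d n} → .{{NonZero n}} → d ∣ n → ∑[ r ∈ upTo n ] 𝟙 (coprime? d r) ≡ density d * fromℕ n
∑-coprime-upTo {d} (divides t refl) = begin
  ∑[ r ∈ upTo (t ℕ.* d) ] 𝟙 (coprime? d r)     ≡⟨ ∑-upTo-periodic d t (𝟙 ∘ coprime? d) (𝟙-coprime-periodic d) ⟩
  fromℕ t * (∑[ r ∈ upTo d ] 𝟙 (coprime? d r)) ≡⟨ cong (fromℕ t *_) (fromℕ-φ d) ⟨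
  fromℕ t * fromℕ (φ d)                        ≡⟨ cong (fromℕ t *_) (m÷n*n≡m (φ d) d) ⟨
  fromℕ t * (density d * fromℕ d)              ≡⟨ *-CS.x∙yz≈y∙xz (fromℕ t) (density d) (fromℕ d) ⟩
  density d * (fromℕ t * fromℕ d)              ≡⟨ cong (density d *_) (fromℕ-* t d) ⟨
  density d * fromℕ (t ℕ.* d)                  ∎
  where
  open ≡-Reasoning
  instance
    _ : NonZero d
    _ = ℕ.m*n≢0⇒n≢0 t

∑-tuples-multiplicative : ∀ n k (g : ℕ → ℚ) → (∀ a b → g (a ℕ.* b) ≡ g a * g b) → g 1 ≡ 1ℚ →
                          ∑[ xs ∈ tuples n k ] g (product xs) ≡ ∑ (upTo n) g ^ k
∑-tuples-multiplicative n zero    g g-* g1≡1 = trans (ℚ.+-identityʳ (g 1)) g1≡1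
∑-tuples-multiplicative n (suc k) g g-* g1≡1 = begin
  ∑ (concatMap (λ r → map (r ∷_) T) (upTo n)) (g ∘ product) ≡⟨ ∑-concatMap (λ r → map (r ∷_) T) (upTo n) (g ∘ product) ⟩
  ∑[ r ∈ upTo n ] ∑ (map (r ∷_) T) (g ∘ product)            ≡⟨ ∑-cong (upTo n) (λ {r} _ → split-first r) ⟩
  ∑[ r ∈ upTo n ] g r * (∑[ xs ∈ T ] g (product xs))        ≡⟨ ∑-*ʳ (upTo n) _ g ⟩
  ∑ (upTo n) g * (∑[ xs ∈ T ] g (product xs))               ≡⟨ cong (∑ (upTo n) g *_) (∑-tuples-multiplicative n k g g-* g1≡1) ⟩
  ∑ (upTo n) g * ∑ (upTo n) g ^ k                           ∎
  where
  open ≡-Reasoning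
  T = tuples n k
  split-first : ∀ r → ∑ (map (r ∷_) T) (g ∘ product) ≡ g r * (∑[ xs ∈ T ] g (product xs))
  split-first r = begin
    ∑ (map (r ∷_) T) (g ∘ product)     ≡⟨ ∑-map (r ∷_) T (g ∘ product) ⟩
    ∑[ xs ∈ T ] g (r ℕ.* product xs)   ≡⟨ ∑-cong T (λ {xs} _ → g-* r (product xs)) ⟩
    ∑[ xs ∈ T ] g r * g (product xs)   ≡⟨ ∑-*ˡ T (g r) (g ∘ product) ⟩
    g r * (∑[ xs ∈ T ] g (product xs)) ∎

survivors-squarefree : ∀ n → .{{NonZero n}} → SquareFree n → ∀ k →
  fromℕ (survivors n k) ≡ ∑[ d ∈ nonunitDivisors n ] - μ d * (density d * fromℕ n) ^ k
survivors-squarefree n n-squarefree k = begin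
  fromℕ (survivors n k)                                        ≡⟨ fromℕ-length-filter (λ xs → ¬? (n ∣? product xs)) T ⟩
  ∑[ xs ∈ T ] 𝟙 (¬? (n ∣? product xs))                         ≡⟨ ∑-cong T (λ {xs} _ → 𝟙-∤-sieve n n-squarefree (product xs)) ⟩
  ∑[ xs ∈ T ] ∑[ d ∈ D ] - μ d * 𝟙 (coprime? d (product xs))   ≡⟨ ∑-swap T D (λ xs d → - μ d * 𝟙 (coprime? d (product xs))) ⟩
  ∑[ d ∈ D ] ∑[ xs ∈ T ] - μ d * 𝟙 (coprime? d (product xs))   ≡⟨ ∑-cong D (λ {d} _ → ∑-*ˡ T (- μ d) (𝟙 ∘ coprime? d ∘ product)) ⟩
  ∑[ d ∈ D ] - μ d * (∑[ xs ∈ T ] 𝟙 (coprime? d (product xs))) ≡⟨ ∑-cong D (λ {d} d∈ → cong (- μ d *_) (coprime-tuples d∈)) ⟩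
  ∑[ d ∈ D ] - μ d * (density d * fromℕ n) ^ k                 ∎
  where
  open ≡-Reasoning
  T = tuples n k
  D = nonunitDivisors n
  coprime-tuples : ∀ {d} → d ∈ D → ∑[ xs ∈ T ] 𝟙 (coprime? d (product xs)) ≡ (density d * fromℕ n) ^ k
  coprime-tuples {d} d∈ = begin
    ∑[ xs ∈ T ] 𝟙 (coprime? d (product xs)) ≡⟨ ∑-tuples-multiplicative n k (𝟙 ∘ coprime? d) (𝟙-coprime-*ʳ d) d⊥1 ⟩
    (∑[ r ∈ upTo n ] 𝟙 (coprime? d r)) ^ k  ≡⟨ cong (_^ k) (∑-coprime-upTo (proj₁ (∈-nonunitDivisors⁻ n d∈))) ⟩
    (density d * fromℕ n) ^ k               ∎
    where
    d⊥1 : 𝟙 (coprime? d 1) ≡ 1ℚ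
    d⊥1 = 𝟙-yes (coprime? d 1) (Coprime.sym (Coprime.1-coprimeTo d))

tailProb-squarefree : ∀ n → .{{NonZero n}} → SquareFree n → ∀ k →
  tailProb n k ≡ ∑[ d ∈ nonunitDivisors n ] - μ d * density d ^ k
tailProb-squarefree n n-squarefree k = ÷ℕ-unique (survivors n k) (n ℕ.^ k) {{ℕ.m^n≢0 n k}} (begin
  (∑[ d ∈ D ] - μ d * density d ^ k) * fromℕ (n ℕ.^ k) ≡⟨ cong (λ c → (∑[ d ∈ D ] - μ d * density d ^ k) * c) (fromℕ-^ n k) ⟩
  (∑[ d ∈ D ] - μ d * density d ^ k) * fromℕ n ^ k     ≡⟨ ∑-*ʳ D (fromℕ n ^ k) (λ d → - μ d * density d ^ k) ⟨
  ∑[ d ∈ D ] - μ d * density d ^ k * fromℕ n ^ k       ≡⟨ ∑-cong D (λ {d} _ → regroup d) ⟩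
  ∑[ d ∈ D ] - μ d * (density d * fromℕ n) ^ k         ≡⟨ survivors-squarefree n n-squarefree k ⟨
  fromℕ (survivors n k)                                ∎)
  where
  open ≡-Reasoning
  D = nonunitDivisors n
  regroup : ∀ d → - μ d * density d ^ k * fromℕ n ^ k ≡ - μ d * (density d * fromℕ n) ^ k
  regroup d = trans (ℚ.*-assoc (- μ d) _ _) (cong (- μ d *_) (sym (^-distrib-* (density d) (fromℕ n) k)))

-- Convergence of the partial sums

geometric-sum : ∀ {q r} → r * (1ℚ - q) ≡ 1ℚ → ∀ K → ∑[ k ∈ upTo K ] q ^ k ≡ r - r * q ^ K
geometric-sum {q} {r} r[1-q]≡1 zero    = sym (r-r*1≡0 r)
  where
  r-r*1≡0 : ∀ r → r - r * 1ℚ ≡ 0ℚ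
  r-r*1≡0 = solve 1 (λ r → r :- r :* con 1ℚ := con 0ℚ) refl
geometric-sum {q} {r} r[1-q]≡1 (suc K) = begin
  ∑[ k ∈ upTo (suc K) ] q ^ k          ≡⟨ ∑-upTo-sucʳ K (q ^_) ⟩
  ∑[ k ∈ upTo K ] q ^ k + q ^ K        ≡⟨ cong₂ _+_ (geometric-sum {q} {r} r[1-q]≡1 K) (sym (trans (cong (_* q ^ K) r[1-q]≡1) (ℚ.*-identityˡ (q ^ K)))) ⟩
  r - r * q ^ K + r * (1ℚ - q) * q ^ K ≡⟨ telescope r q (q ^ K) ⟩
  r - r * (q * q ^ K)                  ∎
  where
  open ≡-Reasoning
  telescope : ∀ r q x → r - r * x + r * (1ℚ - q) * x ≡ r - r * (q * x)
  telescope = solve 3 (λ r q x → r :- r :* x :+ r :* (con 1ℚ :- q) :* x := r :- r :* (q :* x)) refl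

bernoulli : ∀ {q} K → 0ℚ ℚ.≤ q → 0ℚ ℚ.≤ 1ℚ - q → (1ℚ + fromℕ K * (1ℚ - q)) * q ^ K ℚ.≤ 1ℚ
bernoulli {q} zero _ _ = ℚ.≤-reflexive (base q)
  where
  base : ∀ q → (1ℚ + 0ℚ * (1ℚ - q)) * 1ℚ ≡ 1ℚ
  base = solve 1 (λ q → (con 1ℚ :+ con 0ℚ :* (con 1ℚ :- q)) :* con 1ℚ := con 1ℚ) refl
bernoulli {q} (suc K) q≥0 1-q≥0 = begin
  (1ℚ + fromℕ (suc K) * (1ℚ - q)) * (q * q ^ K)                                   ≡⟨ one-more-factor (fromℕ K) q (q ^ K) ⟩
  (1ℚ + fromℕ K * (1ℚ - q)) * q ^ K - fromℕ (suc K) * (1ℚ - q) * (1ℚ - q) * q ^ K ≤⟨ x-y≤x _ loss≥0 ⟩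
  (1ℚ + fromℕ K * (1ℚ - q)) * q ^ K                                               ≤⟨ bernoulli K q≥0 1-q≥0 ⟩
  1ℚ                                                                              ∎
  where
  open ℚ.≤-Reasoning
  loss≥0 : 0ℚ ℚ.≤ fromℕ (suc K) * (1ℚ - q) * (1ℚ - q) * q ^ K
  loss≥0 = nonNeg*nonNeg⇒nonNeg′ (nonNeg*nonNeg⇒nonNeg′ (nonNeg*nonNeg⇒nonNeg′ (fromℕ-nonNeg (suc K)) 1-q≥0) 1-q≥0)
                                 (^-nonNeg K q≥0)
  one-more-factor : ∀ k q x → (1ℚ + (1ℚ + k) * (1ℚ - q)) * (q * x) ≡ (1ℚ + k * (1ℚ - q)) * x - (1ℚ + k) * (1ℚ - q) * (1ℚ - q) * x
  one-more-factor = solve 3 (λ k q x →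
    (con 1ℚ :+ (con 1ℚ :+ k) :* (con 1ℚ :- q)) :* (q :* x)
      := (con 1ℚ :+ k :* (con 1ℚ :- q)) :* x :- (con 1ℚ :+ k) :* (con 1ℚ :- q) :* (con 1ℚ :- q) :* x) refl

K*q^K≤r : ∀ {q r} K → 0ℚ ℚ.≤ q → 0ℚ ℚ.≤ 1ℚ - q → 0ℚ ℚ.≤ r → r * (1ℚ - q) ≡ 1ℚ → fromℕ K * q ^ K ℚ.≤ r
K*q^K≤r {q} {r} K q≥0 1-q≥0 r≥0 r[1-q]≡1 = begin
  fromℕ K * q ^ K                         ≡⟨ ℚ.+-identityˡ _ ⟨
  0ℚ + fromℕ K * q ^ K                    ≤⟨ ℚ.+-monoˡ-≤ (fromℕ K * q ^ K) (nonNeg*nonNeg⇒nonNeg′ r≥0 (^-nonNeg K q≥0)) ⟩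
  r * q ^ K + fromℕ K * q ^ K             ≡⟨ expand ⟨
  r * ((1ℚ + fromℕ K * (1ℚ - q)) * q ^ K) ≤⟨ *-monoˡ-≤-nonNeg′ r r≥0 (bernoulli K q≥0 1-q≥0) ⟩
  r * 1ℚ                                  ≡⟨ ℚ.*-identityʳ r ⟩
  r                                       ∎
  where
  open ℚ.≤-Reasoning
  distribute : ∀ r q k x → r * ((1ℚ + k * (1ℚ - q)) * x) ≡ r * x + k * x * (r * (1ℚ - q))
  distribute = solve 4 (λ r q k x → r :* ((con 1ℚ :+ k :* (con 1ℚ :- q)) :* x) := r :* x :+ k :* x :* (r :* (con 1ℚ :- q))) refl
  expand : r * ((1ℚ + fromℕ K * (1ℚ - q)) * q ^ K) ≡ r * q ^ K + fromℕ K * q ^ K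
  expand = trans (distribute r q (fromℕ K) (q ^ K))
                 (cong (r * q ^ K +_) (trans (cong (fromℕ K * q ^ K *_) r[1-q]≡1) (ℚ.*-identityʳ _)))

φ[d]<d : ∀ {d} → 1 ℕ.< d → φ d ℕ.< d
φ[d]<d {d@(suc d-1)} (ℕ.s<s 0<d-1) =
  subst (φ d ℕ.<_) (List.length-upTo d)
        (List.filter-notAll (λ k → gcd (suc k) d ℕ.≟ 1) (upTo d) (lose (∈-upTo⁺ (ℕ.n<1+n d-1)) gcd[d,d]≢1))
  where
  gcd[d,d]≢1 : gcd d d ≢ 1
  gcd[d,d]≢1 gcd≡1 with ∣1⇒≡1 (subst (d ∣_) gcd≡1 (gcd-greatest ∣-refl ∣-refl))
  ... | refl = ℕ.<-irrefl refl 0<d-1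

-- densitySeries d = d/(d - φ d) = ∑_{k ≥ 0} density d ^ k, and densityTail d K is the part with k ≥ K.
densitySeries : ℕ → ℚ
densitySeries d = d ÷ℕ (d ∸ φ d)

densityTail : ℕ → ℕ → ℚ
densityTail d K = densitySeries d * density d ^ K

densityTail-nonNeg : ∀ d K → 0ℚ ℚ.≤ densityTail d K
densityTail-nonNeg d K = nonNeg*nonNeg⇒nonNeg′ (÷ℕ-nonNeg d (d ∸ φ d)) (^-nonNeg K (÷ℕ-nonNeg (φ d) d))

module _ {d} (1<d : 1 ℕ.< d) where

  private
    instance
      d≢0 : NonZero d
      d≢0 = ℕ.>-nonZero (ℕ.<-trans ℕ.z<s 1<d)
      d∸φ≢0 : NonZero (d ∸ φ d)
      d∸φ≢0 = ℕ.≢-nonZero (ℕ.m>n⇒m∸n≢0 (φ[d]<d 1<d))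

  [1-density]*d≡d∸φ : (1ℚ - density d) * fromℕ d ≡ fromℕ (d ∸ φ d)
  [1-density]*d≡d∸φ = begin
    (1ℚ - density d) * fromℕ d    ≡⟨ distrib (density d) (fromℕ d) ⟩
    fromℕ d - density d * fromℕ d ≡⟨ cong (λ x → fromℕ d - x) (m÷n*n≡m (φ d) d) ⟩
    fromℕ d - fromℕ (φ d)         ≡⟨ fromℕ-∸ (ℕ.<⇒≤ (φ[d]<d 1<d)) ⟨
    fromℕ (d ∸ φ d)               ∎
    where
    open ≡-Reasoning
    distrib : ∀ q x → (1ℚ - q) * x ≡ x - q * x
    distrib = solve 2 (λ q x → (con 1ℚ :- q) :* x := x :- q :* x) refl

  1-density-nonNeg : 0ℚ ℚ.≤ 1ℚ - density d
  1-density-nonNeg = ℚ.*-cancelʳ-≤-pos (fromℕ d) {{ℚ.positive (fromℕ-pos d)}} (begin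
    0ℚ * fromℕ d               ≡⟨ ℚ.*-zeroˡ (fromℕ d) ⟩
    0ℚ                         ≤⟨ fromℕ-nonNeg (d ∸ φ d) ⟩
    fromℕ (d ∸ φ d)            ≡⟨ [1-density]*d≡d∸φ ⟨
    (1ℚ - density d) * fromℕ d ∎)
    where open ℚ.≤-Reasoning

  densitySeries*[1-density]≡1 : densitySeries d * (1ℚ - density d) ≡ 1ℚ
  densitySeries*[1-density]≡1 = *-cancelʳ-≡-pos (fromℕ d) (fromℕ-pos d) (begin
    densitySeries d * (1ℚ - density d) * fromℕ d   ≡⟨ ℚ.*-assoc (densitySeries d) _ _ ⟩
    densitySeries d * ((1ℚ - density d) * fromℕ d) ≡⟨ cong (densitySeries d *_) [1-density]*d≡d∸φ ⟩
    densitySeries d * fromℕ (d ∸ φ d)              ≡⟨ m÷n*n≡m d (d ∸ φ d) ⟩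
    fromℕ d                                        ≡⟨ ℚ.*-identityˡ (fromℕ d) ⟨
    1ℚ * fromℕ d                                   ∎)
    where open ≡-Reasoning

  densitySeries≤self : densitySeries d ℚ.≤ fromℕ d
  densitySeries≤self = begin
    densitySeries d           ≡⟨ ℚ.*-identityʳ (densitySeries d) ⟨
    densitySeries d * fromℕ 1 ≤⟨ *-monoˡ-≤-nonNeg′ (densitySeries d) (÷ℕ-nonNeg d (d ∸ φ d))
                                             (fromℕ-mono-≤ (ℕ.>-nonZero⁻¹ (d ∸ φ d))) ⟩
    densitySeries d * fromℕ (d ∸ φ d) ≡⟨ m÷n*n≡m d (d ∸ φ d) ⟩
    fromℕ d                           ∎
    where open ℚ.≤-Reasoning

  K*densityTail≤d*d : ∀ K → fromℕ K * densityTail d K ℚ.≤ fromℕ d * fromℕ d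
  K*densityTail≤d*d K = begin
    fromℕ K * (s * density d ^ K) ≡⟨ *-CS.x∙yz≈y∙xz (fromℕ K) s (density d ^ K) ⟩
    s * (fromℕ K * density d ^ K) ≤⟨ *-monoˡ-≤-nonNeg′ s s≥0 (K*q^K≤r K (÷ℕ-nonNeg (φ d) d) 1-density-nonNeg s≥0 densitySeries*[1-density]≡1) ⟩
    s * s                         ≤⟨ *-monoʳ-≤-nonNeg′ s s≥0 densitySeries≤self ⟩
    fromℕ d * s                   ≤⟨ *-monoˡ-≤-nonNeg′ (fromℕ d) (fromℕ-nonNeg d) densitySeries≤self ⟩
    fromℕ d * fromℕ d             ∎
    where
    open ℚ.≤-Reasoning
    s = densitySeries d
    s≥0 : 0ℚ ℚ.≤ s
    s≥0 = ÷ℕ-nonNeg d (d ∸ φ d)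

∣negOnePow∣ : ∀ k → ∣ negOnePow k ∣ ≡ 1ℚ
∣negOnePow∣ zero    = refl
∣negOnePow∣ (suc k) = trans (ℚ.∣-p∣≡∣p∣ (negOnePow k)) (∣negOnePow∣ k)

-- The subtracted sum below is rhs n unfolded: negOnePow (suc k) = - negOnePow k makes
-- term d = - μ d * densitySeries d.
partialExp-rhs≡∑tails : ∀ n → .{{NonZero n}} → SquareFree n → ∀ K →
  partialExp n K - rhs n ≡ ∑[ d ∈ nonunitDivisors n ] μ d * densityTail d K
partialExp-rhs≡∑tails n n-squarefree K = begin
  partialExp n K - rhs n
    ≡⟨ cong (_- rhs n) (∑-cong (upTo K) (λ {k} _ → tailProb-squarefree n n-squarefree k)) ⟩
  ∑[ k ∈ upTo K ] ∑[ d ∈ D ] - μ d * density d ^ k - rhs n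
    ≡⟨ cong (_- rhs n) (∑-swap (upTo K) D (λ k d → - μ d * density d ^ k)) ⟩
  ∑[ d ∈ D ] ∑[ k ∈ upTo K ] - μ d * density d ^ k - rhs n
    ≡⟨ cong (_- rhs n) (∑-cong D (λ {d} d∈ → trans (∑-*ˡ (upTo K) (- μ d) (density d ^_)) (cong (- μ d *_) (geometric d∈)))) ⟩
  ∑[ d ∈ D ] - μ d * (densitySeries d - densityTail d K) - ∑[ d ∈ D ] - μ d * densitySeries d
    ≡⟨ ∑-minus D _ _ ⟨
  ∑[ d ∈ D ] (- μ d * (densitySeries d - densityTail d K) - - μ d * densitySeries d)
    ≡⟨ ∑-cong D (λ {d} _ → cancel (μ d) (densitySeries d) (density d ^ K)) ⟩
  ∑[ d ∈ D ] μ d * densityTail d K ∎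
  where
  open ≡-Reasoning
  D = nonunitDivisors n
  geometric : ∀ {d} → d ∈ D → ∑[ k ∈ upTo K ] density d ^ k ≡ densitySeries d - densityTail d K
  geometric {d} d∈ = geometric-sum {r = densitySeries d} (densitySeries*[1-density]≡1 (proj₂ (∈-nonunitDivisors⁻ n d∈))) K
  cancel : ∀ a s x → - a * (s - s * x) - - a * s ≡ a * (s * x)
  cancel = solve 3 (λ a s x → (:- a) :* (s :- s :* x) :- (:- a) :* s := a :* (s :* x)) refl

K*∣partialExp-rhs∣≤n³ : ∀ n → .{{NonZero n}} → SquareFree n → ∀ K →
  fromℕ K * ∣ partialExp n K - rhs n ∣ ℚ.≤ fromℕ (n ℕ.* (n ℕ.* n))
K*∣partialExp-rhs∣≤n³ n n-squarefree K = begin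
  fromℕ K * ∣ partialExp n K - rhs n ∣             ≡⟨ cong (λ e → fromℕ K * ∣ e ∣) (partialExp-rhs≡∑tails n n-squarefree K) ⟩
  fromℕ K * ∣ ∑[ d ∈ D ] μ d * densityTail d K ∣   ≤⟨ *-monoˡ-≤-nonNeg′ (fromℕ K) (fromℕ-nonNeg K) (∣∑∣≤∑∣∣ D _) ⟩
  fromℕ K * (∑[ d ∈ D ] ∣ μ d * densityTail d K ∣) ≡⟨ cong (fromℕ K *_) (∑-cong D (λ {d} _ → ∣μ*tail∣≡tail d)) ⟩
  fromℕ K * (∑[ d ∈ D ] densityTail d K)           ≡⟨ ∑-*ˡ D (fromℕ K) (λ d → densityTail d K) ⟨
  ∑[ d ∈ D ] fromℕ K * densityTail d K             ≤⟨ ∑-mono-≤ D K*tail≤n*n ⟩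
  ∑[ d ∈ D ] fromℕ n * fromℕ n                     ≡⟨ ∑-const D (fromℕ n * fromℕ n) ⟩
  fromℕ (length D) * (fromℕ n * fromℕ n)           ≤⟨ *-monoʳ-≤-nonNeg′ (fromℕ n * fromℕ n) n*n≥0 (fromℕ-mono-≤ (length-nonunitDivisors n)) ⟩
  fromℕ n * (fromℕ n * fromℕ n)                    ≡⟨ trans (fromℕ-* n (n ℕ.* n)) (cong (fromℕ n *_) (fromℕ-* n n)) ⟨
  fromℕ (n ℕ.* (n ℕ.* n))                          ∎
  where
  open ℚ.≤-Reasoning
  D = nonunitDivisors n
  n*n≥0 : 0ℚ ℚ.≤ fromℕ n * fromℕ n
  n*n≥0 = nonNeg*nonNeg⇒nonNeg′ (fromℕ-nonNeg n) (fromℕ-nonNeg n)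
  ∣μ*tail∣≡tail : ∀ d → ∣ μ d * densityTail d K ∣ ≡ densityTail d K
  ∣μ*tail∣≡tail d = begin-equality
    ∣ μ d * densityTail d K ∣     ≡⟨ ℚ.∣p*q∣≡∣p∣*∣q∣ (μ d) (densityTail d K) ⟩
    ∣ μ d ∣ * ∣ densityTail d K ∣ ≡⟨ cong₂ _*_ (∣negOnePow∣ (ω d)) (ℚ.0≤p⇒∣p∣≡p (densityTail-nonNeg d K)) ⟩
    1ℚ * densityTail d K          ≡⟨ ℚ.*-identityˡ (densityTail d K) ⟩
    densityTail d K               ∎
  K*tail≤n*n : ∀ {d} → d ∈ D → fromℕ K * densityTail d K ℚ.≤ fromℕ n * fromℕ n
  K*tail≤n*n {d} d∈ with ∈-nonunitDivisors⁻ n d∈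
  ... | d∣n , 1<d = begin
    fromℕ K * densityTail d K ≤⟨ K*densityTail≤d*d 1<d K ⟩
    fromℕ d * fromℕ d         ≤⟨ *-monoʳ-≤-nonNeg′ (fromℕ d) (fromℕ-nonNeg d) d≤n ⟩
    fromℕ n * fromℕ d         ≤⟨ *-monoˡ-≤-nonNeg′ (fromℕ n) (fromℕ-nonNeg n) d≤n ⟩
    fromℕ n * fromℕ n         ∎
    where
    d≤n : fromℕ d ℚ.≤ fromℕ n
    d≤n = fromℕ-mono-≤ (∣⇒≤ d∣n)

archimedean : ∀ m ε → 0ℚ < ε → ∃[ N ] fromℕ m ℚ.≤ fromℕ N * ε
archimedean m ε@(mkℚ ℤ.+[1+ a ] b-1 _) _ = m ℕ.* suc b-1 , (begin
  fromℕ m                         ≡⟨ ℚ.*-identityʳ (fromℕ m) ⟨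
  fromℕ m * 1ℚ                    ≤⟨ *-monoˡ-≤-nonNeg′ (fromℕ m) (fromℕ-nonNeg m) (fromℕ-mono-≤ {n = suc a} (ℕ.s≤s ℕ.z≤n)) ⟩
  fromℕ m * fromℕ (suc a)         ≡⟨ cong (fromℕ m *_) ε*b≡a ⟨
  fromℕ m * (ε * fromℕ (suc b-1)) ≡⟨ *-CS.x∙yz≈xz∙y (fromℕ m) ε (fromℕ (suc b-1)) ⟩
  fromℕ m * fromℕ (suc b-1) * ε   ≡⟨ cong (_* ε) (fromℕ-* m (suc b-1)) ⟨
  fromℕ (m ℕ.* suc b-1) * ε       ∎)
  where
  open ℚ.≤-Reasoning
  ε*b≡a : ε * fromℕ (suc b-1) ≡ fromℕ (suc a)
  ε*b≡a = trans (cong (_* fromℕ (suc b-1)) (sym (ℚ.↥p/↧p≡p ε))) (m÷n*n≡m (suc a) (suc b-1))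
archimedean m (mkℚ (ℤ.+ 0) _ _) (ℚ.*<* (ℤ.+<+ ()))
archimedean m (mkℚ ℤ.-[1+ _ ] _ _) (ℚ.*<* ())

K*e≤m⇒eventually-e≤ε : ∀ (e : ℕ → ℚ) m → (∀ K → fromℕ K * e K ℚ.≤ fromℕ m) →
                       ∀ ε → 0ℚ < ε → ∃[ N ] ∀ K → N ≤ K → e K ℚ.≤ ε
K*e≤m⇒eventually-e≤ε e m K*e≤m ε ε>0 with archimedean m ε ε>0
... | N , m≤N*ε = suc N , λ K N<K → ℚ.*-cancelˡ-≤-pos (fromℕ K) {{ℚ.positive (fromℕ-pos K {{K≢0 N<K}})}} (begin
  fromℕ K * e K ≤⟨ K*e≤m K ⟩
  fromℕ m       ≤⟨ m≤N*ε ⟩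
  fromℕ N * ε   ≤⟨ *-monoʳ-≤-nonNeg′ ε (ℚ.<⇒≤ ε>0) (fromℕ-mono-≤ (ℕ.<⇒≤ N<K)) ⟩
  fromℕ K * ε   ∎)
  where
  open ℚ.≤-Reasoning
  K≢0 : ∀ {K} → suc N ≤ K → NonZero K
  K≢0 N<K = ℕ.>-nonZero (ℕ.<-≤-trans ℕ.z<s N<K)

theorem3p1 : ∀ (n : ℕ) → 2 ≤ n → SquareFree n →
    ∀ (ε : ℚ) → 0ℚ < ε → ∃[ N ] ∀ (K : ℕ) → N ≤ K →
      ∣ partialExp n K - rhs n ∣ ℚ.≤ ε
theorem3p1 n 2≤n n-squarefree =
  K*e≤m⇒eventually-e≤ε (λ K → ∣ partialExp n K - rhs n ∣) (n ℕ.* (n ℕ.* n))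
                       (K*∣partialExp-rhs∣≤n³ n {{ℕ.>-nonZero (ℕ.<-trans ℕ.z<s 2≤n)}} n-squarefree)
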